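{- Let $\Gamma$ be a weighted digraph with Laplacian matrix $L$ and matrices $Q_k$ as in the context. For $m\ge1$ let $\Gamma_m$ be the weighted digraph on $\{1,\dots,n\}$ having an arc $(i,j)$ with weight $q^m_{ij}$ whenever $j\ne i$ and $q^m_{ij}>0$ (and no other arcs). Then for every $k=0,1,2,\dots$, $LQ_k$ is the Laplacian matrix of $\Gamma_{k+1}$.
   Context: $\Gamma$ is a weighted digraph without loops on vertex set $\{1,\dots,n\}$, $n>1$, with strictly positive arc weights $w_{ij}$ ($w_{ij}=0$ if there is no arc $i\to j$). The Laplacian of a weighted digraph with weights $w_{ij}$ is the matrix $(\ell_{ij})$ with $\ell_{ij}=-w_{ij}$ for $j\ne i$ and $\ell_{ii}=\sum_{k\ne i}w_{ik}$; $L$ is the Laplacian of $\Gamma$. The weight of a subgraph is the product of its arc weights (1 if no arcs); the weight of a set of subgraphs is the sum of their weights (0 if empty). A converging tree is a weakly connected digraph in which one vertex (the root) has outdegree 0 and all others outdegree 1; an in-forest of $\Gamma$ is a spanning subgraph all of whose weak components are converging trees. For $k\ge0$, $Q_k=(q^k_{ij})$ where $q^k_{ij}$ is the total weight of in-forests of $\Gamma$ with $k$ arcs in which $i$ belongs to the tree rooted at $j$. (A Laplacian of the zero-weight digraph, i.e. with no arcs, is the zero matrix.)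
   Formalization: The arc weights $w_{ij}$ of Γ are rational. -}

module Defs where

open import Data.Nat using (ℕ; zero; suc)
import Data.Nat as ℕ
open import Data.Fin using (Fin; zero; suc; _≟_)
open import Data.Bool using (Bool; true; false; if_then_else_)
open import Data.Vec using (Vec; lookup)
open import Data.List as List using (List; map)
open import Data.List.Membership.Propositional using (_∈_)
open import Data.List.Relation.Unary.Unique.Propositional using (Unique)
open import Data.Product using (Σ; ∃; _×_; _,_)
open import Data.Sum using (_⊎_)
open import Relation.Binary.PropositionalEquality using (_≡_)
open import Relation.Nullary using (¬_)
open import Relation.Nullary.Decidable using (⌊_⌋)
open import Function.Bundles using (_⇔_)
open import Data.Rational using (ℚ; 0ℚ; 1ℚ; _+_; _*_; -_; _<_; _≤_; _<?_)

-- Weight matrices (weighted digraphs on Fin n): w i j is the weight of arc i → j,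
-- 0 meaning "no arc".
WMat : ℕ → Set
WMat n = Fin n → Fin n → ℚ

-- A weighted digraph without loops and with strictly positive arc weights:
-- arcs are exactly the pairs with w i j > 0.
IsWeightedDigraph : {n : ℕ} → WMat n → Set
IsWeightedDigraph {n} w = (∀ i → w i i ≡ 0ℚ) × (∀ i j → 0ℚ ≤ w i j)

sumFin : {n : ℕ} → (Fin n → ℚ) → ℚ
sumFin {zero} f = 0ℚ
sumFin {suc n} f = f zero + sumFin (λ i → f (suc i))

prodFin : {n : ℕ} → (Fin n → ℚ) → ℚ
prodFin {zero} f = 1ℚ
prodFin {suc n} f = f zero * prodFin (λ i → f (suc i))

countFin : {n : ℕ} → (Fin n → Bool) → ℕ
countFin {zero} f = 0
countFin {suc n} f = (if f zero then 1 else 0) ℕ.+ countFin (λ i → f (suc i))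

laplacian : {n : ℕ} → WMat n → WMat n
laplacian a i j =
  if ⌊ i ≟ j ⌋
  then sumFin (λ k → if ⌊ i ≟ k ⌋ then 0ℚ else a i k)
  else - a i j

_·_ : {n : ℕ} → WMat n → WMat n → WMat n
(A · B) i j = sumFin (λ l → A i l * B l j)

Subgraph : ℕ → Set
Subgraph n = Vec (Vec Bool n) n

Arc : {n : ℕ} → Subgraph n → Fin n → Fin n → Set
Arc S i j = lookup (lookup S i) j ≡ true

IsSubgraphOf : {n : ℕ} → Subgraph n → WMat n → Set
IsSubgraphOf S w = ∀ i j → Arc S i j → 0ℚ < w i j

outdeg : {n : ℕ} → Subgraph n → Fin n → ℕ
outdeg S i = countFin (λ j → lookup (lookup S i) j)

sumFinℕ : {n : ℕ} → (Fin n → ℕ) → ℕ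
sumFinℕ {zero} f = 0
sumFinℕ {suc n} f = f zero ℕ.+ sumFinℕ (λ i → f (suc i))

numArcs : {n : ℕ} → Subgraph n → ℕ
numArcs S = sumFinℕ (outdeg S)

weight : {n : ℕ} → WMat n → Subgraph n → ℚ
weight w S = prodFin (λ i → prodFin (λ j → if lookup (lookup S i) j then w i j else 1ℚ))

data Conn {n : ℕ} (S : Subgraph n) : Fin n → Fin n → Set where
  here : ∀ {i} → Conn S i i
  fwd  : ∀ {i j k} → Arc S i j → Conn S j k → Conn S i k
  bwd  : ∀ {i j k} → Arc S j i → Conn S j k → Conn S i k

-- In-forest: every weak component is a converging tree, i.e. in each weak
-- component exactly one vertex (the root) has outdegree 0 and all others
-- have outdegree 1 (weak components are weakly connected by definition).
IsInForest : {n : ℕ} → Subgraph n → Set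
IsInForest {n} S =
  (∀ v → outdeg S v ≡ 0 ⊎ outdeg S v ≡ 1) ×
  (∀ v → Σ (Fin n) λ r → Conn S v r × outdeg S r ≡ 0 ×
           (∀ r′ → Conn S v r′ → outdeg S r′ ≡ 0 → r′ ≡ r))

InTreeRootedAt : {n : ℕ} → Subgraph n → Fin n → Fin n → Set
InTreeRootedAt S i j = Conn S i j × outdeg S j ≡ 0

ForestsQ : {n : ℕ} → WMat n → ℕ → Fin n → Fin n → Subgraph n → Set
ForestsQ w k i j S =
  IsSubgraphOf S w × IsInForest S × numArcs S ≡ k × InTreeRootedAt S i j

TotalWeight : {n : ℕ} → WMat n → (Subgraph n → Set) → ℚ → Set
TotalWeight {n} w P x =
  Σ (List (Subgraph n)) λ xs → Unique xs × (∀ S → (S ∈ xs) ⇔ P S) ×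
    x ≡ sumList (map (weight w) xs)
  where
    sumList : List ℚ → ℚ
    sumList List.[] = 0ℚ
    sumList (y List.∷ ys) = y + sumList ys

IsQ : {n : ℕ} → WMat n → ℕ → WMat n → Set
IsQ w k Q = ∀ i j → TotalWeight w (ForestsQ w k i j) (Q i j)

gammaFrom : {n : ℕ} → WMat n → WMat n
gammaFrom q i j = if ⌊ i ≟ j ⌋ then 0ℚ else (if ⌊ 0ℚ <? q i j ⌋ then q i j else 0ℚ)

module Submission where

-- An in-forest is determined by its parent map, so q^k_ij is a weighted count of the maps P
-- that give each vertex at most one parent, are acyclic, have k arcs and send i to the root j.
-- For i ≠ j, (L Q_k)_ij = Σ_l w_il (q^k_ij − q^k_lj); group the maps P by the parent of i.
-- If i is a root of P, only the terms q^k_lj survive, and adding the arc i → l to P runs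
-- through the forests counted by q^{k+1}_ij, so these terms give −q^{k+1}_ij. If i has a
-- parent m, the contribution is a double sum over (m, l) that is antisymmetric and vanishes.
-- On the diagonal: every vertex has exactly one root, so all rows of Q_k have the same sum,
-- the rows of L Q_k sum to zero, and (L Q_k)_ii = Σ_{j ≠ i} q^{k+1}_ij.

open import Defs

open import Data.Bool.Base using (Bool; true; false; if_then_else_)
open import Data.Empty using (⊥-elim)
open import Data.Fin.Base using (Fin; zero; suc; toℕ)
open import Data.Fin.Properties using (_≟_; all?; ¬∀⟶∃¬; pigeonhole; toℕ≤pred[n])
open import Data.List.Base using (List; []; _∷_; _++_; map; filter; cartesianProductWith; allFin; tabulate)
open import Data.List.Membership.Propositional using (_∈_)
open import Data.List.Membership.Propositional.Properties
  using (∈-map⁺; ∈-map⁻; ∈-cartesianProductWith⁺; ∈-allFin; ∈-filter⁺; ∈-filter⁻)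
open import Data.List.Membership.Propositional.Properties.WithK using (unique∧set⇒bag)
open import Data.List.Relation.Binary.BagAndSetEquality using (∼bag⇒↭)
open import Data.List.Relation.Binary.Permutation.Propositional using (_↭_; refl; prep; swap; trans)
import Data.List.Relation.Unary.All as All
open import Data.List.Relation.Unary.AllPairs using ([]; _∷_)
open import Data.List.Relation.Unary.Any using (here; there)
open import Data.List.Relation.Unary.Unique.Propositional using (Unique)
import Data.List.Relation.Unary.Unique.Propositional.Properties as Unique
open import Data.Maybe.Base using (Maybe; just; nothing; fromMaybe; maybe′)
open import Data.Maybe.Properties using (just-injective)
import Data.Maybe.Base as Maybe
import Data.Maybe.Properties as Maybe
import Data.Maybe.Relation.Unary.All as MaybeAll
open import Data.Nat.Base using (ℕ; zero; suc; _<_)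
import Data.Nat as ℕ
open import Data.Nat.GeneralisedArithmetic using (iterate)
open import Data.Nat.Induction using (<-rec)
import Data.Nat.Properties as ℕₚ
open import Data.Nat.Tactic.RingSolver using () renaming (ring to ℕ-ring)
open import Data.Product.Base using (Σ; ∃; _×_; _,_; proj₁; proj₂)
open import Data.Rational using (ℚ; 0ℚ; 1ℚ; _+_; _*_; -_; _-_; _≤_; nonNegative)
import Data.Rational as ℚ
open import Data.Rational.Properties using (+-*-commutativeRing; +-identityʳ; *-zeroʳ)
import Data.Rational.Properties as ℚₚ
open import Data.Sum.Base using (_⊎_; inj₁; inj₂)
open import Data.Vec.Base using (Vec; []; _∷_; lookup; _[_]≔_)
import Data.Vec.Base as Vec
open import Data.Vec.Properties
  using (∷-injective; lookup∘update; lookup∘update′; []≔-lookup; lookup∘tabulate; lookup-map; tabulate∘lookup; tabulate-cong)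
open import Function.Base using (_∘_)
open import Function.Bundles using (_⇔_; mk⇔; Equivalence)
import Function.Properties.Equivalence as ⇔
open import Relation.Binary.Definitions using (DecidableEquality)
open import Relation.Binary.PropositionalEquality using (_≡_; _≢_; refl; sym; cong; cong₂; module ≡-Reasoning)
import Relation.Binary.PropositionalEquality as ≡
open import Relation.Nullary.Decidable
  using (Dec; does; yes; no; _because_; _×-dec_; ¬?; ⌊_⌋; dec⇒maybe; dec-true; dec-false)
open import Relation.Nullary.Negation using (¬_; contradiction)
open import Relation.Unary using (Decidable)
open import Tactic.RingSolver using (solve-∀)
open import Tactic.RingSolver.Core.AlmostCommutativeRing using (AlmostCommutativeRing; fromCommutativeRing)

private variable A B : Set

ℚ-ring : AlmostCommutativeRing _ _
ℚ-ring = fromCommutativeRing +-*-commutativeRing (λ x → dec⇒maybe (0ℚ ℚₚ.≟ x))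

*-nonNeg : {p q : ℚ} → 0ℚ ≤ p → 0ℚ ≤ q → 0ℚ ≤ p * q
*-nonNeg {p} {q} 0≤p 0≤q = ≡.subst (_≤ p * q) (ℚₚ.*-zeroˡ q) (ℚₚ.*-monoʳ-≤-nonNeg q {{nonNegative 0≤q}} 0≤p)

𝟙 : Dec A → ℚ
𝟙 a? = if does a? then 1ℚ else 0ℚ

does≡true⇔ : (a? : Dec A) → (does a? ≡ true) ⇔ A
does≡true⇔ (yes a)  = mk⇔ (λ _ → a) (λ _ → refl)
does≡true⇔ (no ¬a) = mk⇔ (λ ()) (λ a → ⊥-elim (¬a a))

𝟙-true : (a? : Dec A) → A → 𝟙 a? ≡ 1ℚ
𝟙-true a? a = cong (λ b → if b then 1ℚ else 0ℚ) (dec-true a? a)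

𝟙-false : (a? : Dec A) → ¬ A → 𝟙 a? ≡ 0ℚ
𝟙-false a? ¬a = cong (λ b → if b then 1ℚ else 0ℚ) (dec-false a? ¬a)

𝟙-× : (a? : Dec A) (b? : Dec B) → 𝟙 (a? ×-dec b?) ≡ 𝟙 a? * 𝟙 b?
𝟙-× (true  because _) b? = sym (ℚₚ.*-identityˡ (𝟙 b?))
𝟙-× (false because _) b? = sym (ℚₚ.*-zeroˡ (𝟙 b?))

𝟙-nonNeg : (a? : Dec A) → 0ℚ ≤ 𝟙 a?
𝟙-nonNeg (true  because _) = ℚₚ.nonNegative⁻¹ 1ℚ
𝟙-nonNeg (false because _) = ℚₚ.≤-refl

∑ : List A → (A → ℚ) → ℚ
∑ []       f = 0ℚ
∑ (x ∷ xs) f = f x + ∑ xs f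

infix 5 ∑
syntax ∑ xs (λ x → e) = ∑[ x ∈ xs ] e

∑-cong-∈ : (xs : List A) {f g : A → ℚ} → (∀ {x} → x ∈ xs → f x ≡ g x) → ∑ xs f ≡ ∑ xs g
∑-cong-∈ []       f≗g = refl
∑-cong-∈ (x ∷ xs) f≗g = cong₂ _+_ (f≗g (here refl)) (∑-cong-∈ xs (λ x∈xs → f≗g (there x∈xs)))

∑-cong : (xs : List A) {f g : A → ℚ} → (∀ x → f x ≡ g x) → ∑ xs f ≡ ∑ xs g
∑-cong xs f≗g = ∑-cong-∈ xs (λ {x} _ → f≗g x)

∑-zero : (xs : List A) → ∑[ x ∈ xs ] 0ℚ ≡ 0ℚ
∑-zero []       = refl
∑-zero (x ∷ xs) = cong (0ℚ +_) (∑-zero xs)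

∑-+ : (xs : List A) (f g : A → ℚ) → ∑[ x ∈ xs ] (f x + g x) ≡ ∑ xs f + ∑ xs g
∑-+ []       f g = refl
∑-+ (x ∷ xs) f g = ≡.trans (cong (f x + g x +_) (∑-+ xs f g)) (interchange (f x) (g x) _ _)
  where interchange : ∀ a b c d → a + b + (c + d) ≡ a + c + (b + d)
        interchange = solve-∀ ℚ-ring

∑-- : (xs : List A) (f g : A → ℚ) → ∑[ x ∈ xs ] (f x - g x) ≡ ∑ xs f - ∑ xs g
∑-- []       f g = refl
∑-- (x ∷ xs) f g = ≡.trans (cong (f x - g x +_) (∑-- xs f g)) (interchange (f x) (g x) _ _)
  where interchange : ∀ a b c d → a - b + (c - d) ≡ a + c - (b + d)
        interchange = solve-∀ ℚ-ring

∑-*ˡ : (xs : List A) (c : ℚ) (f : A → ℚ) → ∑[ x ∈ xs ] c * f x ≡ c * ∑ xs f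
∑-*ˡ []       c f = sym (*-zeroʳ c)
∑-*ˡ (x ∷ xs) c f = ≡.trans (cong (c * f x +_) (∑-*ˡ xs c f)) (sym (ℚₚ.*-distribˡ-+ c (f x) _))

∑-neg : (xs : List A) (f : A → ℚ) → ∑[ x ∈ xs ] - f x ≡ - ∑ xs f
∑-neg []       f = refl
∑-neg (x ∷ xs) f = ≡.trans (cong (- f x +_) (∑-neg xs f)) (sym (ℚₚ.neg-distrib-+ (f x) _))

∑-comm : (xs : List A) (ys : List B) (f : A → B → ℚ) →
         ∑[ x ∈ xs ] ∑[ y ∈ ys ] f x y ≡ ∑[ y ∈ ys ] ∑[ x ∈ xs ] f x y
∑-comm []       ys f = sym (∑-zero ys)
∑-comm (x ∷ xs) ys f = ≡.trans (cong (∑ ys (f x) +_) (∑-comm xs ys f))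
                               (sym (∑-+ ys (f x) (λ y → ∑[ x ∈ xs ] f x y)))

∑-++ : (xs ys : List A) (f : A → ℚ) → ∑ (xs ++ ys) f ≡ ∑ xs f + ∑ ys f
∑-++ []       ys f = sym (ℚₚ.+-identityˡ _)
∑-++ (x ∷ xs) ys f = ≡.trans (cong (f x +_) (∑-++ xs ys f)) (sym (ℚₚ.+-assoc (f x) _ _))

∑-map : (g : A → B) (xs : List A) (f : B → ℚ) → ∑ (map g xs) f ≡ ∑[ x ∈ xs ] f (g x)
∑-map g []       f = refl
∑-map g (x ∷ xs) f = cong (f (g x) +_) (∑-map g xs f)

∑-filter : {P : A → Set} (P? : Decidable P) (xs : List A) (f : A → ℚ) →
           ∑ (filter P? xs) f ≡ ∑[ x ∈ xs ] 𝟙 (P? x) * f x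
∑-filter P? []       f = refl
∑-filter P? (x ∷ xs) f with does (P? x)
... | true  = cong₂ _+_ (sym (ℚₚ.*-identityˡ (f x))) (∑-filter P? xs f)
... | false = ≡.trans (∑-filter P? xs f) (sym (≡.trans (cong (_+ _) (ℚₚ.*-zeroˡ (f x))) (ℚₚ.+-identityˡ _)))

∑-↭ : {xs ys : List A} (f : A → ℚ) → xs ↭ ys → ∑ xs f ≡ ∑ ys f
∑-↭ f refl                  = refl
∑-↭ f (prep x xs↭ys)        = cong (f x +_) (∑-↭ f xs↭ys)
∑-↭ f (swap x y xs↭ys)      = ≡.trans (cong (λ s → f x + (f y + s)) (∑-↭ f xs↭ys)) (exchange (f x) (f y) _)
  where exchange : ∀ a b c → a + (b + c) ≡ b + (a + c)
        exchange = solve-∀ ℚ-ring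
∑-↭ f (trans xs↭ys ys↭zs)   = ≡.trans (∑-↭ f xs↭ys) (∑-↭ f ys↭zs)

∑-δ : (_≟_ : DecidableEquality A) {xs : List A} {x : A} → Unique xs → x ∈ xs → (f : A → ℚ) →
      ∑[ y ∈ xs ] 𝟙 (x ≟ y) * f y ≡ f x
∑-δ _≟_ {y ∷ ys} {x} (x∉ys ∷ !ys) x∈ f with x ≟ y
... | yes refl = ≡.trans (cong₂ _+_ (ℚₚ.*-identityˡ (f x)) (≡.trans (∑-cong-∈ ys off) (∑-zero ys))) (+-identityʳ (f x))
  where off : ∀ {z} → z ∈ ys → 𝟙 (x ≟ z) * f z ≡ 0ℚ
        off {z} z∈ys with x ≟ z
        ... | yes refl = ⊥-elim (All.lookup x∉ys z∈ys refl)
        ... | no _     = ℚₚ.*-zeroˡ (f z)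
... | no x≢y with x∈
...   | here x≡y   = ⊥-elim (x≢y x≡y)
...   | there x∈ys = ≡.trans (cong₂ _+_ (ℚₚ.*-zeroˡ (f y)) (∑-δ _≟_ !ys x∈ys f)) (ℚₚ.+-identityˡ (f x))

∑-cartesianProductWith : {C : Set} (g : A → B → C) (xs : List A) (ys : List B) (f : C → ℚ) →
  ∑ (cartesianProductWith g xs ys) f ≡ ∑[ x ∈ xs ] ∑[ y ∈ ys ] f (g x y)
∑-cartesianProductWith g []       ys f = refl
∑-cartesianProductWith g (x ∷ xs) ys f = begin
  ∑ (map (g x) ys ++ cartesianProductWith g xs ys) f
    ≡⟨ ∑-++ (map (g x) ys) _ f ⟩
  ∑ (map (g x) ys) f + ∑ (cartesianProductWith g xs ys) f
    ≡⟨ cong₂ _+_ (∑-map (g x) ys f) (∑-cartesianProductWith g xs ys f) ⟩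
  (∑[ y ∈ ys ] f (g x y)) + (∑[ x ∈ xs ] ∑[ y ∈ ys ] f (g x y)) ∎
  where open ≡-Reasoning

∑-antisymmetric : (xs : List A) (a h : A → ℚ) →
  ∑[ x ∈ xs ] a x * (∑[ y ∈ xs ] a y * (h y - h x)) ≡ 0ℚ
∑-antisymmetric xs a h = begin
  ∑[ x ∈ xs ] a x * (∑[ y ∈ xs ] a y * (h y - h x))  ≡⟨ ∑-cong xs (λ x → cong (a x *_) (inner x)) ⟩
  ∑[ x ∈ xs ] a x * (X - h x * Y)                    ≡⟨ ∑-cong xs (λ x → expand (a x) X (h x) Y) ⟩
  ∑[ x ∈ xs ] (X * a x - Y * (a x * h x))            ≡⟨ ∑-- xs _ _ ⟩
  (∑[ x ∈ xs ] X * a x) - (∑[ x ∈ xs ] Y * (a x * h x)) ≡⟨ cong₂ _-_ (∑-*ˡ xs X a) (∑-*ˡ xs Y _) ⟩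
  X * Y - Y * X                                      ≡⟨ cancel X Y ⟩
  0ℚ                                                 ∎
  where
    open ≡-Reasoning
    X Y : ℚ
    X = ∑[ y ∈ xs ] a y * h y
    Y = ∑ xs a
    distrib : ∀ a b c → a * (b - c) ≡ a * b - a * c
    distrib = solve-∀ ℚ-ring
    inner : ∀ x → ∑[ y ∈ xs ] a y * (h y - h x) ≡ X - h x * Y
    inner x = begin
      ∑[ y ∈ xs ] a y * (h y - h x)         ≡⟨ ∑-cong xs (λ y → distrib (a y) (h y) (h x)) ⟩
      ∑[ y ∈ xs ] (a y * h y - a y * h x)   ≡⟨ ∑-- xs _ _ ⟩
      X - (∑[ y ∈ xs ] a y * h x)           ≡⟨ cong (λ z → X - z) (≡.trans (∑-cong xs (λ y → ℚₚ.*-comm (a y) (h x))) (∑-*ˡ xs (h x) a)) ⟩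
      X - h x * Y                           ∎
    expand : ∀ a X h Y → a * (X - h * Y) ≡ X * a - Y * (a * h)
    expand = solve-∀ ℚ-ring
    cancel : ∀ X Y → X * Y - Y * X ≡ 0ℚ
    cancel = solve-∀ ℚ-ring

∑-nonNeg : (xs : List A) {f : A → ℚ} → (∀ x → 0ℚ ≤ f x) → 0ℚ ≤ ∑ xs f
∑-nonNeg []       f≥0 = ℚₚ.≤-refl
∑-nonNeg (x ∷ xs) f≥0 = ℚₚ.+-mono-≤ (f≥0 x) (∑-nonNeg xs f≥0)

allMaybe : List A → List (Maybe A)
allMaybe xs = nothing ∷ map just xs

allMaybe⁺ : {xs : List A} → Unique xs → Unique (allMaybe xs)
allMaybe⁺ !xs = All.tabulate nothing∉ ∷ Unique.map⁺ just-injective !xs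
  where nothing∉ : ∀ {y} → y ∈ map just _ → nothing ≢ y
        nothing∉ y∈ with ∈-map⁻ just y∈
        ... | _ , _ , refl = λ ()

∈-allMaybe : {xs : List A} → (∀ x → x ∈ xs) → ∀ y → y ∈ allMaybe xs
∈-allMaybe complete nothing  = here refl
∈-allMaybe complete (just x) = there (∈-map⁺ just (complete x))

∑-allMaybe : (xs : List A) (f : Maybe A → ℚ) → ∑ (allMaybe xs) f ≡ f nothing + (∑[ x ∈ xs ] f (just x))
∑-allMaybe xs f = cong (f nothing +_) (∑-map just xs f)

allVec : List A → (m : ℕ) → List (Vec A m)
allVec xs zero    = [] ∷ []
allVec xs (suc m) = cartesianProductWith _∷_ xs (allVec xs m)

allVec⁺ : {xs : List A} {m : ℕ} → Unique xs → Unique (allVec xs m)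
allVec⁺ {m = zero}  !xs = All.[] ∷ []
allVec⁺ {m = suc m} !xs = Unique.cartesianProductWith⁺ _∷_ ∷-injective !xs (allVec⁺ !xs)

∈-allVec : {xs : List A} {m : ℕ} → (∀ x → x ∈ xs) → (v : Vec A m) → v ∈ allVec xs m
∈-allVec complete []      = here refl
∈-allVec complete (x ∷ v) = ∈-cartesianProductWith⁺ _∷_ (complete x) (∈-allVec complete v)

-- The partial sum over the i-th coordinate ignores the value of that coordinate,
-- so the partial sums only need to agree at one value a.
∑-allVec-congAt : {m : ℕ} (xs : List A) (a : A) (i : Fin m) {F G : Vec A m → ℚ} →
  (∀ v → lookup v i ≡ a → ∑[ x ∈ xs ] F (v [ i ]≔ x) ≡ ∑[ x ∈ xs ] G (v [ i ]≔ x)) →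
  ∑ (allVec xs m) F ≡ ∑ (allVec xs m) G
∑-allVec-congAt {m = suc m} xs a zero {F} {G} partial = begin
  ∑ (allVec xs (suc m)) F                     ≡⟨ ∑-cartesianProductWith _∷_ xs (allVec xs m) F ⟩
  ∑[ x ∈ xs ] ∑[ v ∈ allVec xs m ] F (x ∷ v)  ≡⟨ ∑-comm xs (allVec xs m) _ ⟩
  ∑[ v ∈ allVec xs m ] ∑[ x ∈ xs ] F (x ∷ v)  ≡⟨ ∑-cong (allVec xs m) (λ v → partial (a ∷ v) refl) ⟩
  ∑[ v ∈ allVec xs m ] ∑[ x ∈ xs ] G (x ∷ v)  ≡⟨ ∑-comm (allVec xs m) xs _ ⟩
  ∑[ x ∈ xs ] ∑[ v ∈ allVec xs m ] G (x ∷ v)  ≡⟨ ∑-cartesianProductWith _∷_ xs (allVec xs m) G ⟨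
  ∑ (allVec xs (suc m)) G                     ∎
  where open ≡-Reasoning
∑-allVec-congAt {m = suc m} xs a (suc i) {F} {G} partial = begin
  ∑ (allVec xs (suc m)) F                     ≡⟨ ∑-cartesianProductWith _∷_ xs (allVec xs m) F ⟩
  ∑[ y ∈ xs ] ∑[ v ∈ allVec xs m ] F (y ∷ v)  ≡⟨ ∑-cong xs (λ y → ∑-allVec-congAt xs a i (λ v → partial (y ∷ v))) ⟩
  ∑[ y ∈ xs ] ∑[ v ∈ allVec xs m ] G (y ∷ v)  ≡⟨ ∑-cartesianProductWith _∷_ xs (allVec xs m) G ⟨
  ∑ (allVec xs (suc m)) G                     ∎
  where open ≡-Reasoning

∑-tabulate : ∀ {n} (g : Fin n → A) (f : A → ℚ) → ∑ (tabulate g) f ≡ sumFin (λ i → f (g i))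
∑-tabulate {n = zero}  g f = refl
∑-tabulate {n = suc n} g f = cong (f (g zero) +_) (∑-tabulate (λ i → g (suc i)) f)

∑-allFin : ∀ {n} (f : Fin n → ℚ) → ∑ (allFin n) f ≡ sumFin f
∑-allFin = ∑-tabulate (λ i → i)

∑-allFin-δ : {n : ℕ} (i : Fin n) (f : Fin n → ℚ) → ∑[ j ∈ allFin n ] 𝟙 (i ≟ j) * f j ≡ f i
∑-allFin-δ {n} i = ∑-δ _≟_ (Unique.allFin⁺ n) (∈-allFin i)

sumFin-cong : {n : ℕ} {f g : Fin n → ℚ} → (∀ i → f i ≡ g i) → sumFin f ≡ sumFin g
sumFin-cong {n} {f} {g} f≗g = ≡.trans (sym (∑-allFin f)) (≡.trans (∑-cong (allFin n) f≗g) (∑-allFin g))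

sumFinℕ-cong : {m : ℕ} {f g : Fin m → ℕ} → (∀ i → f i ≡ g i) → sumFinℕ f ≡ sumFinℕ g
sumFinℕ-cong {zero}  f≗g = refl
sumFinℕ-cong {suc m} f≗g = cong₂ ℕ._+_ (f≗g zero) (sumFinℕ-cong (λ i → f≗g (suc i)))

prodFin-cong : {m : ℕ} {f g : Fin m → ℚ} → (∀ i → f i ≡ g i) → prodFin f ≡ prodFin g
prodFin-cong {zero}  f≗g = refl
prodFin-cong {suc m} f≗g = cong₂ _*_ (f≗g zero) (prodFin-cong (λ i → f≗g (suc i)))

prodFin-nonNeg : {m : ℕ} {f : Fin m → ℚ} → (∀ i → 0ℚ ≤ f i) → 0ℚ ≤ prodFin f
prodFin-nonNeg {zero}  f≥0 = ℚₚ.nonNegative⁻¹ 1ℚ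
prodFin-nonNeg {suc m} f≥0 = *-nonNeg (f≥0 zero) (prodFin-nonNeg (λ i → f≥0 (suc i)))

prodFin-zero : {m : ℕ} {f : Fin m → ℚ} (i : Fin m) → f i ≡ 0ℚ → prodFin f ≡ 0ℚ
prodFin-zero {f = f} zero    fi≡0 = ≡.trans (cong (_* prodFin (λ i → f (suc i))) fi≡0) (ℚₚ.*-zeroˡ (prodFin (λ i → f (suc i))))
prodFin-zero {f = f} (suc i) fi≡0 = ≡.trans (cong (f zero *_) (prodFin-zero i fi≡0)) (*-zeroʳ (f zero))

sumFinℕ-[]≔ : {m : ℕ} (g : B → ℕ) (xs : Vec B m) (i : Fin m) (y : B) →
  sumFinℕ (λ v → g (lookup (xs [ i ]≔ y) v)) ℕ.+ g (lookup xs i) ≡ g y ℕ.+ sumFinℕ (λ v → g (lookup xs v))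
sumFinℕ-[]≔ g (x ∷ xs) zero    y = exchange (g y) _ (g x)
  where exchange : ∀ a b c → a ℕ.+ b ℕ.+ c ≡ a ℕ.+ (c ℕ.+ b)
        exchange = solve-∀ ℕ-ring
sumFinℕ-[]≔ g (x ∷ xs) (suc i) y = begin
  g x ℕ.+ S′ ℕ.+ g (lookup xs i)  ≡⟨ ℕₚ.+-assoc (g x) S′ _ ⟩
  g x ℕ.+ (S′ ℕ.+ g (lookup xs i)) ≡⟨ cong (g x ℕ.+_) (sumFinℕ-[]≔ g xs i y) ⟩
  g x ℕ.+ (g y ℕ.+ S)             ≡⟨ exchange (g x) (g y) S ⟩
  g y ℕ.+ (g x ℕ.+ S)             ∎
  where open ≡-Reasoning
        S′ S : ℕ
        S′ = sumFinℕ (λ v → g (lookup (xs [ i ]≔ y) v))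
        S  = sumFinℕ (λ v → g (lookup xs v))
        exchange : ∀ a b c → a ℕ.+ (b ℕ.+ c) ≡ b ℕ.+ (a ℕ.+ c)
        exchange = solve-∀ ℕ-ring

prodFin-[]≔ : {m : ℕ} (g : Fin m → B → ℚ) (xs : Vec B m) (i : Fin m) (y : B) →
  prodFin (λ v → g v (lookup (xs [ i ]≔ y) v)) * g i (lookup xs i) ≡ g i y * prodFin (λ v → g v (lookup xs v))
prodFin-[]≔ g (x ∷ xs) zero    y = exchange (g zero y) _ (g zero x)
  where exchange : ∀ a b c → a * b * c ≡ a * (c * b)
        exchange = solve-∀ ℚ-ring
prodFin-[]≔ g (x ∷ xs) (suc i) y = begin
  g zero x * Π′ * g (suc i) (lookup xs i)   ≡⟨ ℚₚ.*-assoc (g zero x) Π′ _ ⟩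
  g zero x * (Π′ * g (suc i) (lookup xs i)) ≡⟨ cong (g zero x *_) (prodFin-[]≔ (λ v → g (suc v)) xs i y) ⟩
  g zero x * (g (suc i) y * Π)             ≡⟨ exchange (g zero x) (g (suc i) y) Π ⟩
  g (suc i) y * (g zero x * Π)             ∎
  where open ≡-Reasoning
        Π′ Π : ℚ
        Π′ = prodFin (λ v → g (suc v) (lookup (xs [ i ]≔ y) v))
        Π  = prodFin (λ v → g (suc v) (lookup xs v))
        exchange : ∀ a b c → a * (b * c) ≡ b * (a * c)
        exchange = solve-∀ ℚ-ring

iterate-+ : (f : A → A) (x : A) (s t : ℕ) → iterate f x (s ℕ.+ t) ≡ iterate f (iterate f x s) t
iterate-+ f x zero    t = refl
iterate-+ f x (suc s) t = iterate-+ f (f x) s t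

iterate-fix : {f : A → A} {x : A} → f x ≡ x → (t : ℕ) → iterate f x t ≡ x
iterate-fix             fx≡x zero    = refl
iterate-fix {f = f} fx≡x (suc t) = ≡.trans (cong (λ y → iterate f y t) fx≡x) (iterate-fix fx≡x t)

iterate-commute : (f : A → A) (x : A) (t : ℕ) → iterate f (f x) t ≡ f (iterate f x t)
iterate-commute f x zero    = refl
iterate-commute f x (suc t) = iterate-commute f (f x) t

-- Among the first n+1 iterates two coincide, so a longer path to the fixed point can be shortened.
iterate-fixedPoint-within : {n : ℕ} (f : Fin n → Fin n) {v r : Fin n} → f r ≡ r →
                            (t : ℕ) → iterate f v t ≡ r → iterate f v n ≡ r
iterate-fixedPoint-within {n} f {v} {r} fr≡r = <-rec _ within
  where
    open ≡-Reasoning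
    within : ∀ t → (∀ {s} → s ℕ.< t → iterate f v s ≡ r → iterate f v n ≡ r) →
             iterate f v t ≡ r → iterate f v n ≡ r
    within t shorter vₜ≡r with t ℕ.≤? n
    ... | yes t≤n = begin
      iterate f v n                      ≡⟨ cong (iterate f v) (ℕₚ.m+[n∸m]≡n t≤n) ⟨
      iterate f v (t ℕ.+ (n ℕ.∸ t))      ≡⟨ iterate-+ f v t (n ℕ.∸ t) ⟩
      iterate f (iterate f v t) (n ℕ.∸ t) ≡⟨ cong (λ x → iterate f x (n ℕ.∸ t)) vₜ≡r ⟩
      iterate f r (n ℕ.∸ t)              ≡⟨ iterate-fix fr≡r (n ℕ.∸ t) ⟩
      r                                  ∎
    ... | no t≰n with pigeonhole (ℕₚ.n<1+n n) (λ s → iterate f v (toℕ s))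
    ...   | a , b , a<b , vₐ≡v_b = shorter (≡.subst (toℕ a ℕ.+ d ℕ.<_) b+d≡t (ℕₚ.+-monoˡ-< d a<b)) (begin
      iterate f v (toℕ a ℕ.+ d)             ≡⟨ iterate-+ f v (toℕ a) d ⟩
      iterate f (iterate f v (toℕ a)) d     ≡⟨ cong (λ x → iterate f x d) vₐ≡v_b ⟩
      iterate f (iterate f v (toℕ b)) d     ≡⟨ iterate-+ f v (toℕ b) d ⟨
      iterate f v (toℕ b ℕ.+ d)             ≡⟨ cong (iterate f v) b+d≡t ⟩
      iterate f v t                         ≡⟨ vₜ≡r ⟩
      r                                     ∎)
      where
        d : ℕ
        d = t ℕ.∸ toℕ b
        b+d≡t : toℕ b ℕ.+ d ≡ t
        b+d≡t = ℕₚ.m+[n∸m]≡n (ℕₚ.≤-trans (toℕ≤pred[n] b) (ℕₚ.<⇒≤ (ℕₚ.≰⇒> t≰n)))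

hasArc : Maybe A → ℕ
hasArc = maybe′ (λ _ → 1) 0

-- An in-forest is encoded by its parent map: the head of the unique arc leaving each vertex, if any.
ParentMap : ℕ → Set
ParentMap n = Vec (Maybe (Fin n)) n

module _ {n : ℕ} where

  step : ParentMap n → Fin n → Fin n
  step P v = fromMaybe v (lookup P v)

  root : ParentMap n → Fin n → Fin n
  root P v = iterate (step P) v n

  IsRoot : ParentMap n → Fin n → Set
  IsRoot P r = lookup P r ≡ nothing

  -- A walk that enters a cycle never leaves it, so this rules out cycles.
  Acyclic : ParentMap n → Set
  Acyclic P = ∀ v → IsRoot P (root P v)

  acyclic? : (P : ParentMap n) → Dec (Acyclic P)
  acyclic? P = all? (λ v → Maybe.≡-dec _≟_ (lookup P (root P v)) nothing)

  arcCount : ParentMap n → ℕ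
  arcCount P = sumFinℕ (λ v → hasArc (lookup P v))

  arcProduct : WMat n → ParentMap n → ℚ
  arcProduct w P = prodFin (λ v → maybe′ (w v) 1ℚ (lookup P v))

  module _ (P : ParentMap n) where

    step-root : ∀ {r} → IsRoot P r → step P r ≡ r
    step-root r-root = cong (fromMaybe _) r-root

    root-unique : ∀ {v r} → IsRoot P r → (t : ℕ) → iterate (step P) v t ≡ r → root P v ≡ r
    root-unique r-root = iterate-fixedPoint-within (step P) (step-root r-root)

    root-of-root : ∀ {r} → IsRoot P r → root P r ≡ r
    root-of-root r-root = iterate-fix (step-root r-root) n

    root-step : Acyclic P → ∀ v → root P (step P v) ≡ root P v
    root-step acyclic v = ≡.trans (iterate-commute (step P) v n) (step-root (acyclic v))

module Graft {n : ℕ} (P : ParentMap n) {i : Fin n} (i-root : IsRoot P i) (m : Fin n) where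

  P′ : ParentMap n
  P′ = P [ i ]≔ just m

  lookup-≢ : ∀ {v} → v ≢ i → lookup P′ v ≡ lookup P v
  lookup-≢ v≢i = lookup∘update′ v≢i P (just m)

  i-not-root : ¬ IsRoot P′ i
  i-not-root i-root′ with () ← ≡.trans (sym (lookup∘update i P (just m))) i-root′

  step-≢ : ∀ {v} → v ≢ i → step P′ v ≡ step P v
  step-≢ v≢i = cong (fromMaybe _) (lookup-≢ v≢i)

  step-i : step P′ i ≡ m
  step-i = cong (fromMaybe i) (lookup∘update i P (just m))

  arcCount-graft : arcCount P′ ≡ suc (arcCount P)
  arcCount-graft = begin
    arcCount P′                         ≡⟨ ℕₚ.+-identityʳ (arcCount P′) ⟨
    arcCount P′ ℕ.+ 0                   ≡⟨ cong (λ x → arcCount P′ ℕ.+ hasArc x) i-root ⟨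
    arcCount P′ ℕ.+ hasArc (lookup P i) ≡⟨ sumFinℕ-[]≔ hasArc P i (just m) ⟩
    suc (arcCount P)                    ∎
    where open ≡-Reasoning

  walk-until-i : ∀ t v → iterate (step P) v t ≡ iterate (step P′) v t ⊎ iterate (step P) v t ≡ i
  walk-until-i zero    v = inj₁ refl
  walk-until-i (suc t) v with v ≟ i
  ... | yes refl = inj₂ (iterate-fix (step-root P i-root) (suc t))
  ... | no  v≢i rewrite step-≢ v≢i = walk-until-i t (step P v)

  walk-avoiding-i : ∀ t v {r} → iterate (step P) v t ≡ r → r ≢ i → iterate (step P′) v t ≡ r
  walk-avoiding-i t v vₜ≡r r≢i with walk-until-i t v
  ... | inj₁ same = ≡.trans (sym same) vₜ≡r
  ... | inj₂ at-i = ⊥-elim (r≢i (≡.trans (sym vₜ≡r) at-i))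

  walk-to-i : ∀ t v → iterate (step P) v t ≡ i → ∃ λ s → iterate (step P′) v s ≡ m
  walk-to-i t v vₜ≡i with v ≟ i
  ... | yes refl = 1 , step-i
  walk-to-i zero    v refl | no v≢i = ⊥-elim (v≢i refl)
  walk-to-i (suc t) v vₜ≡i | no v≢i with walk-to-i t (step P v) vₜ≡i
  ... | s , walk = suc s , ≡.trans (cong (λ x → iterate (step P′) x s) (step-≢ v≢i)) walk

  root′ : Fin n → Fin n
  root′ l = if does (root P l ≟ i) then root P m else root P l

  root′-i : root′ i ≡ root P m
  root′-i with root P i ≟ i
  ... | yes _   = refl
  ... | no  i↛i = ⊥-elim (i↛i (root-of-root P i-root))

  graft-root : Acyclic P → root P m ≢ i → ∀ l → root P′ l ≡ root′ l
  graft-root acyclic m↛i l with root P l ≟ i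
  ... | no  l↛i = root-unique P′ (≡.trans (lookup-≢ l↛i) (acyclic l)) n (walk-avoiding-i n l refl l↛i)
  ... | yes l↝i with walk-to-i n l l↝i
  ...   | s , l↝m = root-unique P′ (≡.trans (lookup-≢ m↛i) (acyclic m)) (s ℕ.+ n) (begin
    iterate (step P′) l (s ℕ.+ n)               ≡⟨ iterate-+ (step P′) l s n ⟩
    iterate (step P′) (iterate (step P′) l s) n ≡⟨ cong (λ x → iterate (step P′) x n) l↝m ⟩
    iterate (step P′) m n                       ≡⟨ walk-avoiding-i n m refl m↛i ⟩
    root P m                                    ∎)
    where open ≡-Reasoning

  graft-acyclic : Acyclic P → root P m ≢ i → Acyclic P′
  graft-acyclic acyclic m↛i l rewrite graft-root acyclic m↛i l with root P l ≟ i
  ... | yes _   = ≡.trans (lookup-≢ m↛i) (acyclic m)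
  ... | no  l↛i = ≡.trans (lookup-≢ l↛i) (acyclic l)

  InTree-i : Fin n → Set
  InTree-i x = ∃ λ t → iterate (step P) x t ≡ i

  inTree-step : InTree-i m → ∀ {x} → InTree-i x → InTree-i (step P′ x)
  inTree-step m↝i {x} x↝i with x ≟ i | x↝i
  ... | yes refl | _            = ≡.subst InTree-i (sym step-i) m↝i
  ... | no  x≢i  | zero  , x≡i  = ⊥-elim (x≢i x≡i)
  ... | no  x≢i  | suc t , walk = t , ≡.trans (cong (λ y → iterate (step P) y t) (step-≢ x≢i)) walk

  inTree-iterate : InTree-i m → ∀ t {x} → InTree-i x → InTree-i (iterate (step P′) x t)
  inTree-iterate m↝i zero    x↝i = x↝i
  inTree-iterate m↝i (suc t) x↝i = inTree-iterate m↝i t (inTree-step m↝i x↝i)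

  inTree-not-root : ∀ {x} → InTree-i x → ¬ IsRoot P′ x
  inTree-not-root {x} (t , walk) x-root′ with x ≟ i
  ... | yes refl = i-not-root x-root′
  ... | no  x≢i  = x≢i (≡.trans (sym (iterate-fix (step-root P (≡.trans (sym (lookup-≢ x≢i)) x-root′)) t)) walk)

  -- If m lies in the tree of i, grafting closes a cycle through i.
  graft-acyclic⁻ : Acyclic P′ → Acyclic P × root P m ≢ i
  graft-acyclic⁻ acyclic′ = acyclic , m↛i
    where
      acyclic : Acyclic P
      acyclic v with walk-until-i n v
      ... | inj₂ v↝i  = ≡.trans (cong (lookup P) v↝i) i-root
      ... | inj₁ same = ≡.trans (cong (lookup P) same) (≡.trans (sym (lookup-≢ r≢i)) (acyclic′ v))
        where r≢i : root P′ v ≢ i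
              r≢i r≡i = i-not-root (≡.subst (IsRoot P′) r≡i (acyclic′ v))
      m↛i : root P m ≢ i
      m↛i m↝i = inTree-not-root (inTree-iterate (n , m↝i) n (0 , refl)) (acyclic′ i)

  𝟙-acyclic-root : ∀ l j →
    𝟙 (acyclic? P′) * 𝟙 (root P′ l ≟ j) ≡ 𝟙 (acyclic? P) * 𝟙 (¬? (root P m ≟ i)) * 𝟙 (root′ l ≟ j)
  𝟙-acyclic-root l j = ≡.trans (by-cases (acyclic? P ×-dec ¬? (root P m ≟ i)))
                               (cong (_* 𝟙 (root′ l ≟ j)) (𝟙-× (acyclic? P) (¬? (root P m ≟ i))))
    where
      by-cases : (d : Dec (Acyclic P × root P m ≢ i)) → 𝟙 (acyclic? P′) * 𝟙 (root P′ l ≟ j) ≡ 𝟙 d * 𝟙 (root′ l ≟ j)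
      by-cases (yes (acyclic , m↛i)) =
        cong₂ (λ a r → a * 𝟙 (r ≟ j)) (𝟙-true (acyclic? P′) (graft-acyclic acyclic m↛i)) (graft-root acyclic m↛i l)
      by-cases (no not-both) = ≡.trans (cong (_* 𝟙 (root P′ l ≟ j)) (𝟙-false (acyclic? P′) (not-both ∘ graft-acyclic⁻)))
                                       (≡.trans (ℚₚ.*-zeroˡ (𝟙 (root P′ l ≟ j))) (sym (ℚₚ.*-zeroˡ (𝟙 (root′ l ≟ j)))))

module _ {n : ℕ} where

  ·-congʳ : (A B C : WMat n) (i j : Fin n) → (∀ l → B l j ≡ C l j) → (A · B) i j ≡ (A · C) i j
  ·-congʳ A B C i j B≗C = sumFin-cong (λ l → cong (A i l *_) (B≗C l))

  laplacian-cong : (a b : WMat n) (i : Fin n) → (∀ j → i ≢ j → a i j ≡ b i j) →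
                   ∀ j → laplacian a i j ≡ laplacian b i j
  laplacian-cong a b i a≗b j with i ≟ j
  ... | yes _   = sumFin-cong off-diagonal
    where off-diagonal : ∀ k → (if ⌊ i ≟ k ⌋ then 0ℚ else a i k) ≡ (if ⌊ i ≟ k ⌋ then 0ℚ else b i k)
          off-diagonal k with i ≟ k
          ... | yes _   = refl
          ... | no  i≢k = a≗b k i≢k
  ... | no  i≢j = cong -_ (a≗b j i≢j)

  laplacian·≡∑ : (w Q : WMat n) (i j : Fin n) →
                 (laplacian w · Q) i j ≡ ∑[ l ∈ allFin n ] w i l * (Q i j - Q l j)
  laplacian·≡∑ w Q i j = begin
    sumFin (λ l → laplacian w i l * Q l j)
      ≡⟨ ∑-allFin (λ l → laplacian w i l * Q l j) ⟨
    ∑[ l ∈ allFin n ] laplacian w i l * Q l j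
      ≡⟨ ∑-cong (allFin n) split ⟩
    ∑[ l ∈ allFin n ] (𝟙 (i ≟ l) * (d * Q i j) - ŵ l * Q l j)
      ≡⟨ ∑-- (allFin n) _ _ ⟩
    (∑[ l ∈ allFin n ] 𝟙 (i ≟ l) * (d * Q i j)) - (∑[ l ∈ allFin n ] ŵ l * Q l j)
      ≡⟨ cong (_- S) (∑-allFin-δ i (λ _ → d * Q i j)) ⟩
    d * Q i j - (∑[ l ∈ allFin n ] ŵ l * Q l j)
      ≡⟨ cong (_- S) (≡.trans (cong (Q i j *_) (∑-allFin ŵ)) (ℚₚ.*-comm (Q i j) d)) ⟨
    Q i j * ∑ (allFin n) ŵ - (∑[ l ∈ allFin n ] ŵ l * Q l j)
      ≡⟨ cong (_- S) (∑-*ˡ (allFin n) (Q i j) ŵ) ⟨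
    (∑[ l ∈ allFin n ] Q i j * ŵ l) - (∑[ l ∈ allFin n ] ŵ l * Q l j)
      ≡⟨ ∑-- (allFin n) _ _ ⟨
    ∑[ l ∈ allFin n ] (Q i j * ŵ l - ŵ l * Q l j)
      ≡⟨ ∑-cong (allFin n) drop-diagonal ⟩
    ∑[ l ∈ allFin n ] w i l * (Q i j - Q l j)
      ∎
    where
      open ≡-Reasoning
      ŵ : Fin n → ℚ
      ŵ l = if ⌊ i ≟ l ⌋ then 0ℚ else w i l
      d S : ℚ
      d = sumFin ŵ
      S = ∑[ l ∈ allFin n ] ŵ l * Q l j
      split : ∀ l → laplacian w i l * Q l j ≡ 𝟙 (i ≟ l) * (d * Q i j) - ŵ l * Q l j
      split l with i ≟ l
      ... | yes refl = on-diagonal d (Q i j)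
        where on-diagonal : ∀ d q → d * q ≡ 1ℚ * (d * q) - 0ℚ * q
              on-diagonal = solve-∀ ℚ-ring
      ... | no  _    = off-diagonal (w i l) (d * Q i j) (Q l j)
        where off-diagonal : ∀ a b q → - a * q ≡ 0ℚ * b - a * q
              off-diagonal = solve-∀ ℚ-ring
      drop-diagonal : ∀ l → Q i j * ŵ l - ŵ l * Q l j ≡ w i l * (Q i j - Q l j)
      drop-diagonal l with i ≟ l
      ... | yes refl = vanish (Q i j) (w i i)
        where vanish : ∀ q a → q * 0ℚ - 0ℚ * q ≡ a * (q - q)
              vanish = solve-∀ ℚ-ring
      ... | no  _    = factor (Q i j) (w i l) (Q l j)
        where factor : ∀ q a q′ → q * a - a * q′ ≡ a * (q - q′)
              factor = solve-∀ ℚ-ring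

  zero-rowSum⇒laplacian : (M R : WMat n) (i : Fin n) → ∑[ j ∈ allFin n ] M i j ≡ 0ℚ →
    (∀ j → i ≢ j → M i j ≡ - R i j) → ∀ j → M i j ≡ laplacian R i j
  zero-rowSum⇒laplacian M R i rowSum off j with i ≟ j
  ... | no  i≢j = off j i≢j
  ... | yes refl = begin
    M i i                                   ≡⟨ add-sub (M i i) (∑ (allFin n) M̂) ⟩
    M i i + ∑ (allFin n) M̂ - ∑ (allFin n) M̂ ≡⟨ cong (_- ∑ (allFin n) M̂) split-row ⟩
    ∑ (allFin n) (M i) - ∑ (allFin n) M̂     ≡⟨ cong (_- ∑ (allFin n) M̂) rowSum ⟩
    0ℚ - ∑ (allFin n) M̂                     ≡⟨ ℚₚ.+-identityˡ _ ⟩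
    - ∑ (allFin n) M̂                        ≡⟨ cong -_ (≡.trans (∑-cong (allFin n) negated) (∑-neg (allFin n) R̂)) ⟩
    - - ∑ (allFin n) R̂                      ≡⟨ neg-neg _ ⟩
    ∑ (allFin n) R̂                          ≡⟨ ∑-allFin R̂ ⟩
    sumFin R̂                                ∎
    where
      open ≡-Reasoning
      M̂ R̂ : Fin n → ℚ
      M̂ k = if ⌊ i ≟ k ⌋ then 0ℚ else M i k
      R̂ k = if ⌊ i ≟ k ⌋ then 0ℚ else R i k
      add-sub : ∀ x y → x ≡ x + y - y
      add-sub = solve-∀ ℚ-ring
      neg-neg : ∀ x → - - x ≡ x
      neg-neg = solve-∀ ℚ-ring
      recombine : ∀ k → 𝟙 (i ≟ k) * M i k + M̂ k ≡ M i k
      recombine k with i ≟ k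
      ... | yes refl = ≡.trans (+-identityʳ _) (ℚₚ.*-identityˡ _)
      ... | no  _    = ≡.trans (cong (_+ M i k) (ℚₚ.*-zeroˡ (M i k))) (ℚₚ.+-identityˡ _)
      split-row : M i i + ∑ (allFin n) M̂ ≡ ∑ (allFin n) (M i)
      split-row = begin
        M i i + ∑ (allFin n) M̂                                  ≡⟨ cong (_+ ∑ (allFin n) M̂) (∑-allFin-δ i (M i)) ⟨
        (∑[ k ∈ allFin n ] 𝟙 (i ≟ k) * M i k) + ∑ (allFin n) M̂ ≡⟨ ∑-+ (allFin n) (λ k → 𝟙 (i ≟ k) * M i k) M̂ ⟨
        ∑[ k ∈ allFin n ] (𝟙 (i ≟ k) * M i k + M̂ k)            ≡⟨ ∑-cong (allFin n) recombine ⟩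
        ∑ (allFin n) (M i)                                      ∎
      negated : ∀ k → M̂ k ≡ - R̂ k
      negated k with i ≟ k
      ... | yes _   = refl
      ... | no  i≢k = off k i≢k

module ForestMatrix {n : ℕ} (w : WMat n) where

  parentMaps : List (ParentMap n)
  parentMaps = allVec (allMaybe (allFin n)) n

  forestTerm : ℕ → Fin n → Fin n → ParentMap n → ℚ
  forestTerm k i j P = 𝟙 (acyclic? P) * 𝟙 (arcCount P ℕ.≟ k) * 𝟙 (root P i ≟ j) * arcProduct w P

  -- Unlike ForestsQ this has no positivity condition on arcs: for w ≥ 0 a map using a
  -- non-arc has weight 0.
  forestMatrix : ℕ → WMat n
  forestMatrix k i j = ∑[ P ∈ parentMaps ] forestTerm k i j P

  Δ : ℕ → Fin n → Fin n → ParentMap n → ℚ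
  Δ k i j P = ∑[ l ∈ allFin n ] w i l * (forestTerm k l j P - forestTerm k i j P)

  module _ (P : ParentMap n) {i : Fin n} (i-root : IsRoot P i) where

    arcProduct-graft : ∀ m → arcProduct w (P [ i ]≔ just m) ≡ w i m * arcProduct w P
    arcProduct-graft m = begin
      arcProduct w P′                                ≡⟨ ℚₚ.*-identityʳ _ ⟨
      arcProduct w P′ * 1ℚ                           ≡⟨ cong (λ x → arcProduct w P′ * maybe′ (w i) 1ℚ x) i-root ⟨
      arcProduct w P′ * maybe′ (w i) 1ℚ (lookup P i) ≡⟨ prodFin-[]≔ (λ v → maybe′ (w v) 1ℚ) P i (just m) ⟩
      w i m * arcProduct w P                         ∎
      where open ≡-Reasoning
            P′ : ParentMap n
            P′ = P [ i ]≔ just m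

    forestTerm-root : ∀ {k j} → i ≢ j → forestTerm k i j P ≡ 0ℚ
    forestTerm-root {k} {j} i≢j
      rewrite dec-false (root P i ≟ j) (λ i↝j → i≢j (≡.trans (sym (root-of-root P i-root)) i↝j))
      = vanish (𝟙 (acyclic? P)) (𝟙 (arcCount P ℕ.≟ k)) (arcProduct w P)
      where vanish : ∀ a b c → a * b * 0ℚ * c ≡ 0ℚ
            vanish = solve-∀ ℚ-ring

    -- The weight of the arc i → x, counted only if adding it keeps P acyclic.
    graftWeight : Fin n → ℚ
    graftWeight x = w i x * 𝟙 (¬? (root P x ≟ i))

    module _ (m : Fin n) where
      open Graft P i-root m

      forestTerm-graft : ∀ k l j → forestTerm k l j P′ ≡
        𝟙 (acyclic? P) * 𝟙 (¬? (root P m ≟ i)) * 𝟙 (suc (arcCount P) ℕ.≟ k) * 𝟙 (root′ l ≟ j) * (w i m * arcProduct w P)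
      forestTerm-graft k l j = begin
        forestTerm k l j P′
          ≡⟨ cong₂ (λ c v → 𝟙 (acyclic? P′) * 𝟙 (c ℕ.≟ k) * 𝟙 (root P′ l ≟ j) * v) arcCount-graft (arcProduct-graft m) ⟩
        𝟙 (acyclic? P′) * C * 𝟙 (root P′ l ≟ j) * W
          ≡⟨ regroup (𝟙 (acyclic? P′)) C (𝟙 (root P′ l ≟ j)) W ⟩
        𝟙 (acyclic? P′) * 𝟙 (root P′ l ≟ j) * (C * W)
          ≡⟨ cong (_* (C * W)) (𝟙-acyclic-root l j) ⟩
        𝟙 (acyclic? P) * 𝟙 (¬? (root P m ≟ i)) * 𝟙 (root′ l ≟ j) * (C * W)
          ≡⟨ regroup′ (𝟙 (acyclic? P)) (𝟙 (¬? (root P m ≟ i))) (𝟙 (root′ l ≟ j)) C W ⟩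
        𝟙 (acyclic? P) * 𝟙 (¬? (root P m ≟ i)) * C * 𝟙 (root′ l ≟ j) * W
          ∎
        where
          open ≡-Reasoning
          C W : ℚ
          C = 𝟙 (suc (arcCount P) ℕ.≟ k)
          W = w i m * arcProduct w P
          regroup : ∀ a c r v → a * c * r * v ≡ a * r * (c * v)
          regroup = solve-∀ ℚ-ring
          regroup′ : ∀ a x r c v → a * x * r * (c * v) ≡ a * x * c * r * v
          regroup′ = solve-∀ ℚ-ring

      forestTerm-graft-root : ∀ {k j} → i ≢ j → forestTerm (suc k) i j P′ ≡ w i m * forestTerm k m j P
      forestTerm-graft-root {k} {j} i≢j = begin
        forestTerm (suc k) i j P′
          ≡⟨ forestTerm-graft (suc k) i j ⟩
        a * x * C * 𝟙 (root′ i ≟ j) * (w i m * arcProduct w P)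
          ≡⟨ cong (λ r → a * x * C * 𝟙 (r ≟ j) * (w i m * arcProduct w P)) root′-i ⟩
        a * x * C * y * (w i m * arcProduct w P)
          ≡⟨ regroup a x C y (w i m) (arcProduct w P) ⟩
        w i m * (a * C * (x * y) * arcProduct w P)
          ≡⟨ cong (λ z → w i m * (a * C * z * arcProduct w P)) outside-tree ⟩
        w i m * forestTerm k m j P
          ∎
        where
          open ≡-Reasoning
          a x y C : ℚ
          a = 𝟙 (acyclic? P)
          x = 𝟙 (¬? (root P m ≟ i))
          y = 𝟙 (root P m ≟ j)
          C = 𝟙 (arcCount P ℕ.≟ k)
          regroup : ∀ a x c y v p → a * x * c * y * (v * p) ≡ v * (a * c * (x * y) * p)
          regroup = solve-∀ ℚ-ring
          outside-tree : x * y ≡ y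
          outside-tree with root P m ≟ i
          ... | no  _   = ℚₚ.*-identityˡ y
          ... | yes m↝i = ≡.trans (ℚₚ.*-zeroˡ y) (sym (𝟙-false (root P m ≟ j) (λ m↝j → i≢j (≡.trans (sym m↝i) m↝j))))

      forestTerm-graft-difference : ∀ k l j → forestTerm k l j P′ - forestTerm k i j P′ ≡
        𝟙 (acyclic? P) * 𝟙 (suc (arcCount P) ℕ.≟ k) * arcProduct w P * graftWeight m *
        (𝟙 (¬? (root P l ≟ i)) * (𝟙 (root P l ≟ j) - 𝟙 (root P m ≟ j)))
      forestTerm-graft-difference k l j = begin
        forestTerm k l j P′ - forestTerm k i j P′
          ≡⟨ cong₂ _-_ (forestTerm-graft k l j) (forestTerm-graft k i j) ⟩
        a * x * C * 𝟙 (root′ l ≟ j) * W - a * x * C * 𝟙 (root′ i ≟ j) * W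
          ≡⟨ cong (λ r → a * x * C * 𝟙 (root′ l ≟ j) * W - a * x * C * 𝟙 (r ≟ j) * W) root′-i ⟩
        a * x * C * 𝟙 (root′ l ≟ j) * W - a * x * C * 𝟙 (root P m ≟ j) * W
          ≡⟨ factor a x C (𝟙 (root′ l ≟ j)) (𝟙 (root P m ≟ j)) (w i m) (arcProduct w P) ⟩
        a * C * arcProduct w P * (w i m * x) * (𝟙 (root′ l ≟ j) - 𝟙 (root P m ≟ j))
          ≡⟨ cong (a * C * arcProduct w P * (w i m * x) *_) reroot-difference ⟩
        a * C * arcProduct w P * (w i m * x) * (𝟙 (¬? (root P l ≟ i)) * (𝟙 (root P l ≟ j) - 𝟙 (root P m ≟ j)))
          ∎
        where
          open ≡-Reasoning
          a x C W : ℚ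
          a = 𝟙 (acyclic? P)
          x = 𝟙 (¬? (root P m ≟ i))
          C = 𝟙 (suc (arcCount P) ℕ.≟ k)
          W = w i m * arcProduct w P
          factor : ∀ a x c h h′ v p → a * x * c * h * (v * p) - a * x * c * h′ * (v * p) ≡ a * c * p * (v * x) * (h - h′)
          factor = solve-∀ ℚ-ring
          reroot-difference : 𝟙 (root′ l ≟ j) - 𝟙 (root P m ≟ j) ≡
                              𝟙 (¬? (root P l ≟ i)) * (𝟙 (root P l ≟ j) - 𝟙 (root P m ≟ j))
          reroot-difference with root P l ≟ i
          ... | yes _ = cancel (𝟙 (root P m ≟ j)) (𝟙 (root P l ≟ j))
            where cancel : ∀ h h′ → h - h ≡ 0ℚ * (h′ - h)
                  cancel = solve-∀ ℚ-ring
          ... | no  _ = sym (ℚₚ.*-identityˡ _)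

    P[i]≔nothing : P [ i ]≔ nothing ≡ P
    P[i]≔nothing = ≡.trans (cong (P [ i ]≔_) (sym i-root)) ([]≔-lookup P i)

    ∑-reparent-forestTerm : ∀ {k j} → i ≢ j →
      ∑[ x ∈ allMaybe (allFin n) ] forestTerm (suc k) i j (P [ i ]≔ x) ≡ ∑[ m ∈ allFin n ] w i m * forestTerm k m j P
    ∑-reparent-forestTerm {k} {j} i≢j = begin
      ∑[ x ∈ allMaybe (allFin n) ] forestTerm (suc k) i j (P [ i ]≔ x)
        ≡⟨ ∑-allMaybe (allFin n) (λ x → forestTerm (suc k) i j (P [ i ]≔ x)) ⟩
      forestTerm (suc k) i j (P [ i ]≔ nothing) + (∑[ m ∈ allFin n ] forestTerm (suc k) i j (P [ i ]≔ just m))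
        ≡⟨ cong₂ _+_ (≡.trans (cong (forestTerm (suc k) i j) P[i]≔nothing) (forestTerm-root i≢j))
                     (∑-cong (allFin n) (λ m → forestTerm-graft-root m i≢j)) ⟩
      0ℚ + (∑[ m ∈ allFin n ] w i m * forestTerm k m j P)
        ≡⟨ ℚₚ.+-identityˡ _ ⟩
      ∑[ m ∈ allFin n ] w i m * forestTerm k m j P
        ∎
      where open ≡-Reasoning

    -- After factoring, the double sum over (m, l) is antisymmetric.
    Δ-grafts : ∀ k j → ∑[ m ∈ allFin n ] Δ k i j (P [ i ]≔ just m) ≡ 0ℚ
    Δ-grafts k j = begin
      ∑[ m ∈ allFin n ] ∑[ l ∈ allFin n ] w i l * (forestTerm k l j (P [ i ]≔ just m) - forestTerm k i j (P [ i ]≔ just m))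
        ≡⟨ ∑-cong (allFin n) (λ m → ∑-cong (allFin n) (λ l →
             ≡.trans (cong (w i l *_) (forestTerm-graft-difference m k l j))
                     (regroup E (graftWeight m) (w i l) (𝟙 (¬? (root P l ≟ i))) (h l) (h m)))) ⟩
      ∑[ m ∈ allFin n ] ∑[ l ∈ allFin n ] E * graftWeight m * (graftWeight l * (h l - h m))
        ≡⟨ ∑-cong (allFin n) (λ m → ≡.trans (∑-*ˡ (allFin n) (E * graftWeight m) _) (ℚₚ.*-assoc E (graftWeight m) _)) ⟩
      ∑[ m ∈ allFin n ] E * (graftWeight m * (∑[ l ∈ allFin n ] graftWeight l * (h l - h m)))
        ≡⟨ ∑-*ˡ (allFin n) E _ ⟩
      E * (∑[ m ∈ allFin n ] graftWeight m * (∑[ l ∈ allFin n ] graftWeight l * (h l - h m)))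
        ≡⟨ cong (E *_) (∑-antisymmetric (allFin n) graftWeight h) ⟩
      E * 0ℚ
        ≡⟨ *-zeroʳ E ⟩
      0ℚ ∎
      where
        open ≡-Reasoning
        E : ℚ
        E = 𝟙 (acyclic? P) * 𝟙 (suc (arcCount P) ℕ.≟ k) * arcProduct w P
        h : Fin n → ℚ
        h x = 𝟙 (root P x ≟ j)
        regroup : ∀ e g v o hl hm → v * (e * g * (o * (hl - hm))) ≡ e * g * (v * o * (hl - hm))
        regroup = solve-∀ ℚ-ring

    ∑-reparent-Δ : ∀ {k j} → i ≢ j →
      ∑[ x ∈ allMaybe (allFin n) ] Δ k i j (P [ i ]≔ x) ≡ ∑[ m ∈ allFin n ] w i m * forestTerm k m j P
    ∑-reparent-Δ {k} {j} i≢j = begin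
      ∑[ x ∈ allMaybe (allFin n) ] Δ k i j (P [ i ]≔ x)
        ≡⟨ ∑-allMaybe (allFin n) (λ x → Δ k i j (P [ i ]≔ x)) ⟩
      Δ k i j (P [ i ]≔ nothing) + (∑[ m ∈ allFin n ] Δ k i j (P [ i ]≔ just m))
        ≡⟨ cong₂ _+_ (cong (Δ k i j) P[i]≔nothing) (Δ-grafts k j) ⟩
      Δ k i j P + 0ℚ
        ≡⟨ +-identityʳ _ ⟩
      ∑[ l ∈ allFin n ] w i l * (forestTerm k l j P - forestTerm k i j P)
        ≡⟨ ∑-cong (allFin n) (λ l → cong (λ t → w i l * (forestTerm k l j P - t)) (forestTerm-root i≢j)) ⟩
      ∑[ l ∈ allFin n ] w i l * (forestTerm k l j P - 0ℚ)
        ≡⟨ ∑-cong (allFin n) (λ l → cong (w i l *_) (ℚₚ.+-identityʳ _)) ⟩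
      ∑[ m ∈ allFin n ] w i m * forestTerm k m j P
        ∎
      where open ≡-Reasoning

  forestMatrix-recurrence : ∀ k {i j} → i ≢ j →
    ∑[ l ∈ allFin n ] w i l * (forestMatrix k l j - forestMatrix k i j) ≡ forestMatrix (suc k) i j
  forestMatrix-recurrence k {i} {j} i≢j = begin
    ∑[ l ∈ allFin n ] w i l * (forestMatrix k l j - forestMatrix k i j)
      ≡⟨ ∑-cong (allFin n) (λ l → ≡.trans (cong (w i l *_) (sym (∑-- parentMaps _ _))) (sym (∑-*ˡ parentMaps (w i l) _))) ⟩
    ∑[ l ∈ allFin n ] ∑[ P ∈ parentMaps ] w i l * (forestTerm k l j P - forestTerm k i j P)
      ≡⟨ ∑-comm (allFin n) parentMaps _ ⟩
    ∑[ P ∈ parentMaps ] Δ k i j P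
      ≡⟨ ∑-allVec-congAt (allMaybe (allFin n)) nothing i
           (λ P i-root → ≡.trans (∑-reparent-Δ P i-root i≢j) (sym (∑-reparent-forestTerm P i-root i≢j))) ⟩
    forestMatrix (suc k) i j
      ∎
    where open ≡-Reasoning

  forestTotal : ℕ → ℚ
  forestTotal k = ∑[ P ∈ parentMaps ] 𝟙 (acyclic? P) * 𝟙 (arcCount P ℕ.≟ k) * arcProduct w P

  forestMatrix-rowSum : ∀ k l → ∑[ j ∈ allFin n ] forestMatrix k l j ≡ forestTotal k
  forestMatrix-rowSum k l = ≡.trans (∑-comm (allFin n) parentMaps _) (∑-cong parentMaps one-root)
    where
      regroup : ∀ a b r p → a * b * r * p ≡ r * (a * b * p)
      regroup = solve-∀ ℚ-ring
      one-root : ∀ P → ∑[ j ∈ allFin n ] forestTerm k l j P ≡ 𝟙 (acyclic? P) * 𝟙 (arcCount P ℕ.≟ k) * arcProduct w P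
      one-root P = ≡.trans
        (∑-cong (allFin n) (λ j → regroup (𝟙 (acyclic? P)) (𝟙 (arcCount P ℕ.≟ k)) (𝟙 (root P l ≟ j)) (arcProduct w P)))
        (∑-allFin-δ (root P l) _)

  laplacian·forestMatrix : ∀ k i j → (laplacian w · forestMatrix k) i j ≡ laplacian (forestMatrix (suc k)) i j
  laplacian·forestMatrix k i j =
    ≡.trans (laplacian·≡∑ w (forestMatrix k) i j)
            (zero-rowSum⇒laplacian M (forestMatrix (suc k)) i zero-rowSum off-diagonal j)
    where
      open ≡-Reasoning
      M : WMat n
      M a b = ∑[ l ∈ allFin n ] w a l * (forestMatrix k a b - forestMatrix k l b)
      flip : ∀ v q q′ → v * (q - q′) ≡ - (v * (q′ - q))
      flip = solve-∀ ℚ-ring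
      off-diagonal : ∀ j → i ≢ j → M i j ≡ - forestMatrix (suc k) i j
      off-diagonal j i≢j = begin
        M i j                                                                ≡⟨ ∑-cong (allFin n) (λ l → flip (w i l) (forestMatrix k i j) (forestMatrix k l j)) ⟩
        ∑[ l ∈ allFin n ] - (w i l * (forestMatrix k l j - forestMatrix k i j)) ≡⟨ ∑-neg (allFin n) _ ⟩
        - (∑[ l ∈ allFin n ] w i l * (forestMatrix k l j - forestMatrix k i j)) ≡⟨ cong -_ (forestMatrix-recurrence k i≢j) ⟩
        - forestMatrix (suc k) i j                                           ∎
      vanish : ∀ v σ → v * (σ - σ) ≡ 0ℚ
      vanish = solve-∀ ℚ-ring
      zero-rowSum : ∑[ j ∈ allFin n ] M i j ≡ 0ℚ
      zero-rowSum = begin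
        ∑[ j ∈ allFin n ] ∑[ l ∈ allFin n ] w i l * (forestMatrix k i j - forestMatrix k l j)
          ≡⟨ ∑-comm (allFin n) (allFin n) _ ⟩
        ∑[ l ∈ allFin n ] ∑[ j ∈ allFin n ] w i l * (forestMatrix k i j - forestMatrix k l j)
          ≡⟨ ∑-cong (allFin n) (λ l → ≡.trans (∑-*ˡ (allFin n) (w i l) _) (cong (w i l *_) (∑-- (allFin n) _ _))) ⟩
        ∑[ l ∈ allFin n ] w i l * ((∑[ j ∈ allFin n ] forestMatrix k i j) - (∑[ j ∈ allFin n ] forestMatrix k l j))
          ≡⟨ ∑-cong (allFin n) (λ l → cong (w i l *_) (cong₂ _-_ (forestMatrix-rowSum k i) (forestMatrix-rowSum k l))) ⟩
        ∑[ l ∈ allFin n ] w i l * (forestTotal k - forestTotal k)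
          ≡⟨ ∑-cong (allFin n) (λ l → vanish (w i l) (forestTotal k)) ⟩
        ∑[ l ∈ allFin n ] 0ℚ
          ≡⟨ ∑-zero (allFin n) ⟩
        0ℚ ∎

arcsFrom : {m : ℕ} → Maybe (Fin m) → Vec Bool m
arcsFrom p = Vec.tabulate (λ u → does (Maybe.≡-dec _≟_ p (just u)))

countTrue : {m : ℕ} → Vec Bool m → ℕ
countTrue r = countFin (lookup r)

countTrue-arcsFrom : {m : ℕ} (p : Maybe (Fin m)) → countTrue (arcsFrom p) ≡ hasArc p
countTrue-arcsFrom {zero}  nothing        = refl
countTrue-arcsFrom {suc m} nothing        = countTrue-arcsFrom {m} nothing
countTrue-arcsFrom {suc m} (just zero)    = cong suc (countTrue-arcsFrom {m} nothing)
countTrue-arcsFrom {suc m} (just (suc u)) = countTrue-arcsFrom (just u)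

prodFin-arcsFrom : {m : ℕ} (g : Fin m → ℚ) (p : Maybe (Fin m)) →
  prodFin (λ u → if lookup (arcsFrom p) u then g u else 1ℚ) ≡ maybe′ g 1ℚ p
prodFin-arcsFrom {zero}  g nothing        = refl
prodFin-arcsFrom {suc m} g nothing        = ≡.trans (ℚₚ.*-identityˡ _) (prodFin-arcsFrom (λ u → g (suc u)) nothing)
prodFin-arcsFrom {suc m} g (just zero)    = ≡.trans (cong (g zero *_) (prodFin-arcsFrom (λ u → g (suc u)) nothing)) (ℚₚ.*-identityʳ _)
prodFin-arcsFrom {suc m} g (just (suc u)) = ≡.trans (ℚₚ.*-identityˡ _) (prodFin-arcsFrom (λ u → g (suc u)) (just u))

arcsFrom-true⇔ : {m : ℕ} (p : Maybe (Fin m)) (u : Fin m) → (lookup (arcsFrom p) u ≡ true) ⇔ (p ≡ just u)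
arcsFrom-true⇔ p u = ≡.subst (λ b → (b ≡ true) ⇔ (p ≡ just u)) (sym (lookup∘tabulate _ u))
                             (does≡true⇔ (Maybe.≡-dec _≟_ p (just u)))

firstTrue : {m : ℕ} → Vec Bool m → Maybe (Fin m)
firstTrue []          = nothing
firstTrue (true ∷ r)  = just zero
firstTrue (false ∷ r) = Maybe.map suc (firstTrue r)

firstTrue-arcsFrom : {m : ℕ} (p : Maybe (Fin m)) → firstTrue (arcsFrom p) ≡ p
firstTrue-arcsFrom {zero}  nothing        = refl
firstTrue-arcsFrom {suc m} nothing        = cong (Maybe.map suc) (firstTrue-arcsFrom {m} nothing)
firstTrue-arcsFrom {suc m} (just zero)    = refl
firstTrue-arcsFrom {suc m} (just (suc u)) = cong (Maybe.map suc) (firstTrue-arcsFrom (just u))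

arcsFrom-injective : {m : ℕ} {p p′ : Maybe (Fin m)} → arcsFrom p ≡ arcsFrom p′ → p ≡ p′
arcsFrom-injective {p = p} {p′} eq =
  ≡.trans (sym (firstTrue-arcsFrom p)) (≡.trans (cong firstTrue eq) (firstTrue-arcsFrom p′))

arcsFrom-suc : {m : ℕ} (p : Maybe (Fin m)) → arcsFrom (Maybe.map suc p) ≡ false ∷ arcsFrom p
arcsFrom-suc nothing  = refl
arcsFrom-suc (just u) = refl

arcsFrom-firstTrue : {m : ℕ} (r : Vec Bool m) → countTrue r ≡ 0 ⊎ countTrue r ≡ 1 → arcsFrom (firstTrue r) ≡ r
arcsFrom-firstTrue []          _        = refl
arcsFrom-firstTrue (true ∷ r)  (inj₂ c) = cong (true ∷_) (all-false r (ℕₚ.suc-injective c))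
  where all-false : {m : ℕ} (r : Vec Bool m) → countTrue r ≡ 0 → arcsFrom nothing ≡ r
        all-false []          _ = refl
        all-false (false ∷ r) c = cong (false ∷_) (all-false r c)
arcsFrom-firstTrue (false ∷ r) c        = ≡.trans (arcsFrom-suc (firstTrue r)) (cong (false ∷_) (arcsFrom-firstTrue r c))

module _ {n : ℕ} where

  toSubgraph : ParentMap n → Subgraph n
  toSubgraph = Vec.map arcsFrom

  toSubgraph-injective : {P Q : ParentMap n} → toSubgraph P ≡ toSubgraph Q → P ≡ Q
  toSubgraph-injective {P} {Q} eq = begin
    P                       ≡⟨ tabulate∘lookup P ⟨
    Vec.tabulate (lookup P) ≡⟨ tabulate-cong (λ v → arcsFrom-injective (row v)) ⟩
    Vec.tabulate (lookup Q) ≡⟨ tabulate∘lookup Q ⟩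
    Q                       ∎
    where
      open ≡-Reasoning
      row : ∀ v → arcsFrom (lookup P v) ≡ arcsFrom (lookup Q v)
      row v = ≡.trans (sym (lookup-map v arcsFrom P)) (≡.trans (cong (λ S → lookup S v) eq) (lookup-map v arcsFrom Q))

  toSubgraph-onto : {m : ℕ} (S : Vec (Vec Bool n) m) →
    (∀ v → countTrue (lookup S v) ≡ 0 ⊎ countTrue (lookup S v) ≡ 1) → Vec.map arcsFrom (Vec.map firstTrue S) ≡ S
  toSubgraph-onto []      _     = refl
  toSubgraph-onto (r ∷ S) deg≤1 = cong₂ _∷_ (arcsFrom-firstTrue r (deg≤1 zero)) (toSubgraph-onto S (λ v → deg≤1 (suc v)))

  module _ (P : ParentMap n) where

    private
      S : Subgraph n
      S = toSubgraph P

    lookup-toSubgraph : ∀ v → lookup S v ≡ arcsFrom (lookup P v)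
    lookup-toSubgraph v = lookup-map v arcsFrom P

    Arc⇔parent : ∀ {v u} → Arc S v u ⇔ lookup P v ≡ just u
    Arc⇔parent {v} {u} = ≡.subst (λ r → (lookup r u ≡ true) ⇔ (lookup P v ≡ just u))
                                 (sym (lookup-toSubgraph v)) (arcsFrom-true⇔ (lookup P v) u)

    step-Arc : ∀ {v u} → Arc S v u → step P v ≡ u
    step-Arc arc = cong (fromMaybe _) (Equivalence.to Arc⇔parent arc)

    outdeg-toSubgraph : ∀ v → outdeg S v ≡ hasArc (lookup P v)
    outdeg-toSubgraph v = ≡.trans (cong countTrue (lookup-toSubgraph v)) (countTrue-arcsFrom (lookup P v))

    outdeg≡0⇔IsRoot : ∀ {r} → outdeg S r ≡ 0 ⇔ IsRoot P r
    outdeg≡0⇔IsRoot {r} = mk⇔ (λ od≡0 → no-arc (lookup P r) (≡.trans (sym (outdeg-toSubgraph r)) od≡0))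
                              (λ r-root → ≡.trans (outdeg-toSubgraph r) (cong hasArc r-root))
      where no-arc : (p : Maybe (Fin n)) → hasArc p ≡ 0 → p ≡ nothing
            no-arc nothing _ = refl

    numArcs-toSubgraph : numArcs S ≡ arcCount P
    numArcs-toSubgraph = sumFinℕ-cong outdeg-toSubgraph

    weight-toSubgraph : (w : WMat n) → weight w S ≡ arcProduct w P
    weight-toSubgraph w = prodFin-cong (λ v → ≡.trans
      (prodFin-cong (λ u → cong (λ b → if b then w v u else 1ℚ) (cong (λ r → lookup r u) (lookup-toSubgraph v))))
      (prodFin-arcsFrom (w v) (lookup P v)))

    walk⇒Conn : ∀ t v → Conn S v (iterate (step P) v t)
    walk⇒Conn zero    v = here
    walk⇒Conn (suc t) v with lookup P v in parent
    ... | nothing = walk⇒Conn t v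
    ... | just u  = fwd (Equivalence.from Arc⇔parent parent) (walk⇒Conn t u)

    Conn⇒walk : ∀ {v r} → IsRoot P r → Conn S v r → ∃ λ t → iterate (step P) v t ≡ r
    Conn⇒walk r-root here = 0 , refl
    Conn⇒walk r-root (fwd arc c) with Conn⇒walk r-root c
    ... | t , walk = suc t , ≡.trans (cong (λ x → iterate (step P) x t) (step-Arc arc)) walk
    Conn⇒walk r-root (bwd arc c) with Conn⇒walk r-root c
    ... | zero  , refl = contradiction (≡.trans (sym r-root) (Equivalence.to Arc⇔parent arc)) λ ()
    ... | suc t , walk = t , ≡.trans (cong (λ x → iterate (step P) x t) (sym (step-Arc arc))) walk

    Conn⇒same-root : Acyclic P → ∀ {a b} → Conn S a b → root P a ≡ root P b
    Conn⇒same-root acyclic here        = refl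
    Conn⇒same-root acyclic {a} (fwd arc c) =
      ≡.trans (≡.trans (sym (root-step P acyclic a)) (cong (root P) (step-Arc arc))) (Conn⇒same-root acyclic c)
    Conn⇒same-root acyclic (bwd {j = j} arc c) =
      ≡.trans (≡.trans (cong (root P) (sym (step-Arc arc))) (root-step P acyclic j)) (Conn⇒same-root acyclic c)

    InTree⇔root : Acyclic P → ∀ {i j} → InTreeRootedAt S i j ⇔ root P i ≡ j
    InTree⇔root acyclic {i} = mk⇔
      (λ (c , od≡0) → ≡.trans (Conn⇒same-root acyclic c) (root-of-root P (Equivalence.to outdeg≡0⇔IsRoot od≡0)))
      (λ { refl → walk⇒Conn n i , Equivalence.from outdeg≡0⇔IsRoot (acyclic i) })

    InForest⇔Acyclic : IsInForest S ⇔ Acyclic P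
    InForest⇔Acyclic = mk⇔ forest⇒acyclic acyclic⇒forest
      where
        forest⇒acyclic : IsInForest S → Acyclic P
        forest⇒acyclic (_ , trees) v with trees v
        ... | r , c , od≡0 , _ with Conn⇒walk (Equivalence.to outdeg≡0⇔IsRoot od≡0) c
        ...   | t , walk = ≡.subst (IsRoot P) (sym (root-unique P r-root t walk)) r-root
          where r-root : IsRoot P r
                r-root = Equivalence.to outdeg≡0⇔IsRoot od≡0
        acyclic⇒forest : Acyclic P → IsInForest S
        acyclic⇒forest acyclic = degree≤1 , tree
          where
            degree≤1 : ∀ v → outdeg S v ≡ 0 ⊎ outdeg S v ≡ 1
            degree≤1 v with lookup P v in parent
            ... | nothing = inj₁ (≡.trans (outdeg-toSubgraph v) (cong hasArc parent))
            ... | just _  = inj₂ (≡.trans (outdeg-toSubgraph v) (cong hasArc parent))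
            tree : ∀ v → Σ (Fin n) λ r → Conn S v r × outdeg S r ≡ 0 × (∀ r′ → Conn S v r′ → outdeg S r′ ≡ 0 → r′ ≡ r)
            tree v with Equivalence.from (InTree⇔root acyclic {v}) refl
            ... | c , od≡0 = root P v , c , od≡0 , λ r′ c′ od′≡0 → sym (Equivalence.to (InTree⇔root acyclic) (c′ , od′≡0))

TotalWeight≡∑ : {n : ℕ} {w : WMat n} {P : Subgraph n → Set} {x : ℚ} (tw : TotalWeight w P x) →
                x ≡ ∑ (proj₁ tw) (weight w)
TotalWeight≡∑ {w = w} tw = go _ tw refl
  where
    -- The list sum in TotalWeight is local to its definition; it is reached by
    -- re-packing each tail as the total weight of its own member set.
    go : ∀ xs {P x} (tw : TotalWeight w P x) → proj₁ tw ≡ xs → x ≡ ∑ xs (weight w)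
    go []       (.[] , _ , _ , x≡) refl = x≡
    go (S ∷ xs) (.(S ∷ xs) , _ ∷ !xs , _ , x≡) refl =
      ≡.trans x≡ (cong (weight w S +_) (go xs (xs , !xs , (λ _ → ⇔.refl) , refl) refl))

module _ {n : ℕ} (w : WMat n) where

  PositiveArcs : ParentMap n → Set
  PositiveArcs P = ∀ v → MaybeAll.All (λ u → 0ℚ ℚ.< w v u) (lookup P v)

  positiveArcs? : (P : ParentMap n) → Dec (PositiveArcs P)
  positiveArcs? P = all? (λ v → MaybeAll.dec (λ u → 0ℚ ℚ.<? w v u) (lookup P v))

  IsSubgraphOf⇔PositiveArcs : (P : ParentMap n) → IsSubgraphOf (toSubgraph P) w ⇔ PositiveArcs P
  IsSubgraphOf⇔PositiveArcs P = mk⇔ to from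
    where
      to : IsSubgraphOf (toSubgraph P) w → PositiveArcs P
      to sub v with lookup P v in parent
      ... | nothing = MaybeAll.nothing
      ... | just u  = MaybeAll.just (sub v u (Equivalence.from (Arc⇔parent P) parent))
      from : PositiveArcs P → IsSubgraphOf (toSubgraph P) w
      from positive v u arc with lookup P v | positive v | Equivalence.to (Arc⇔parent P) arc
      ... | just _ | MaybeAll.just 0<w | refl = 0<w

  ForestsQ⇔ : ∀ k i j (P : ParentMap n) →
    ForestsQ w k i j (toSubgraph P) ⇔ (PositiveArcs P × Acyclic P × arcCount P ≡ k × root P i ≡ j)
  ForestsQ⇔ k i j P = mk⇔
    (λ (sub , forest , arcs≡k , tree) → let acyclic = Equivalence.to (InForest⇔Acyclic P) forest in
      Equivalence.to (IsSubgraphOf⇔PositiveArcs P) sub , acyclic ,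
      ≡.trans (sym (numArcs-toSubgraph P)) arcs≡k , Equivalence.to (InTree⇔root P acyclic) tree)
    (λ (positive , acyclic , arcs≡k , root≡j) →
      Equivalence.from (IsSubgraphOf⇔PositiveArcs P) positive , Equivalence.from (InForest⇔Acyclic P) acyclic ,
      ≡.trans (numArcs-toSubgraph P) arcs≡k , Equivalence.from (InTree⇔root P acyclic) root≡j)

  module _ (w≥0 : ∀ i j → 0ℚ ≤ w i j) where

    arcProduct-nonNeg : ∀ P → 0ℚ ≤ arcProduct w P
    arcProduct-nonNeg P = prodFin-nonNeg (λ v → factor (lookup P v))
      where factor : ∀ {v} (p : Maybe (Fin n)) → 0ℚ ≤ maybe′ (w v) 1ℚ p
            factor nothing  = ℚₚ.nonNegative⁻¹ 1ℚ
            factor (just u) = w≥0 _ u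

    arcProduct-¬PositiveArcs : ∀ P → ¬ PositiveArcs P → arcProduct w P ≡ 0ℚ
    arcProduct-¬PositiveArcs P not-positive
      with v , not-positive-at-v ← ¬∀⟶∃¬ n _ (λ v → MaybeAll.dec (λ u → 0ℚ ℚ.<? w v u) (lookup P v)) not-positive
      = prodFin-zero v (zero-factor (lookup P v) not-positive-at-v)
      where zero-factor : (p : Maybe (Fin n)) → ¬ MaybeAll.All (λ u → 0ℚ ℚ.< w v u) p → maybe′ (w v) 1ℚ p ≡ 0ℚ
            zero-factor nothing  ¬all = ⊥-elim (¬all MaybeAll.nothing)
            zero-factor (just u) ¬all = ℚₚ.≤-antisym (ℚₚ.≮⇒≥ (¬all ∘ MaybeAll.just)) (w≥0 v u)

    open ForestMatrix w

    forestMatrix-nonNeg : ∀ k i j → 0ℚ ≤ forestMatrix k i j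
    forestMatrix-nonNeg k i j = ∑-nonNeg parentMaps (λ P →
      *-nonNeg (*-nonNeg (*-nonNeg (𝟙-nonNeg (acyclic? P)) (𝟙-nonNeg (arcCount P ℕ.≟ k))) (𝟙-nonNeg (root P i ≟ j)))
               (arcProduct-nonNeg P))

    forest? : ∀ k i j (P : ParentMap n) → Dec (PositiveArcs P × Acyclic P × arcCount P ≡ k × root P i ≡ j)
    forest? k i j P = positiveArcs? P ×-dec acyclic? P ×-dec arcCount P ℕ.≟ k ×-dec root P i ≟ j

    forests : ℕ → Fin n → Fin n → List (Subgraph n)
    forests k i j = map toSubgraph (filter (forest? k i j) parentMaps)

    forests-unique : ∀ k i j → Unique (forests k i j)
    forests-unique k i j = Unique.map⁺ toSubgraph-injective {xs = filter (forest? k i j) parentMaps}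
      (Unique.filter⁺ (forest? k i j) {xs = parentMaps} (allVec⁺ (allMaybe⁺ (Unique.allFin⁺ n))))

    ∈-forests⇔ : ∀ k i j {S} → S ∈ forests k i j ⇔ ForestsQ w k i j S
    ∈-forests⇔ k i j {S} = mk⇔ to from
      where
        to : S ∈ forests k i j → ForestsQ w k i j S
        to S∈ with P , P∈ , refl ← ∈-map⁻ toSubgraph S∈ =
          Equivalence.from (ForestsQ⇔ k i j P) (proj₂ (∈-filter⁻ (forest? k i j) {xs = parentMaps} P∈))
        from : ForestsQ w k i j S → S ∈ forests k i j
        from forestsQ@(_ , (degree≤1 , _) , _) = ≡.subst (_∈ forests k i j) P↦S
          (∈-map⁺ toSubgraph (∈-filter⁺ (forest? k i j) (∈-allVec (∈-allMaybe ∈-allFin) P)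
                                        (Equivalence.to (ForestsQ⇔ k i j P) (≡.subst (ForestsQ w k i j) (sym P↦S) forestsQ))))
          where P : ParentMap n
                P = Vec.map firstTrue S
                P↦S : toSubgraph P ≡ S
                P↦S = toSubgraph-onto S degree≤1

    𝟙-forest? : ∀ k i j P → 𝟙 (forest? k i j P) * weight w (toSubgraph P) ≡ forestTerm k i j P
    𝟙-forest? k i j P = begin
      𝟙 (forest? k i j P) * weight w (toSubgraph P)
        ≡⟨ cong₂ _*_ (≡.trans (𝟙-× (positiveArcs? P) (acyclic? P ×-dec arcCount P ℕ.≟ k ×-dec root P i ≟ j))
                       (cong (𝟙 (positiveArcs? P) *_) (≡.trans (𝟙-× (acyclic? P) (arcCount P ℕ.≟ k ×-dec root P i ≟ j))
                       (cong (a *_) (𝟙-× (arcCount P ℕ.≟ k) (root P i ≟ j))))))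
                     (weight-toSubgraph P w) ⟩
      𝟙 (positiveArcs? P) * (a * (c * r)) * arcProduct w P
        ≡⟨ by-positivity (positiveArcs? P) ⟩
      a * c * r * arcProduct w P
        ∎
      where
        open ≡-Reasoning
        a c r : ℚ
        a = 𝟙 (acyclic? P)
        c = 𝟙 (arcCount P ℕ.≟ k)
        r = 𝟙 (root P i ≟ j)
        by-positivity : (p? : Dec (PositiveArcs P)) → 𝟙 p? * (a * (c * r)) * arcProduct w P ≡ a * c * r * arcProduct w P
        by-positivity (yes _) = regroup a c r (arcProduct w P)
          where regroup : ∀ a c r p → 1ℚ * (a * (c * r)) * p ≡ a * c * r * p
                regroup = solve-∀ ℚ-ring
        by-positivity (no not-positive) rewrite arcProduct-¬PositiveArcs P not-positive = vanish a c r
          where vanish : ∀ a c r → 0ℚ * (a * (c * r)) * 0ℚ ≡ a * c * r * 0ℚ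
                vanish = solve-∀ ℚ-ring

    IsQ⇒forestMatrix : ∀ {k} {Q : WMat n} → IsQ w k Q → ∀ i j → Q i j ≡ forestMatrix k i j
    IsQ⇒forestMatrix {k} {Q} isQ i j with isQ i j
    ... | tw@(xs , !xs , xs⇔ , _) = begin
      Q i j                                                    ≡⟨ TotalWeight≡∑ tw ⟩
      ∑ xs (weight w)                                          ≡⟨ ∑-↭ (weight w) xs↭forests ⟩
      ∑ (forests k i j) (weight w)                             ≡⟨ ∑-map toSubgraph (filter (forest? k i j) parentMaps) (weight w) ⟩
      ∑[ P ∈ filter (forest? k i j) parentMaps ] weight w (toSubgraph P)
                                                               ≡⟨ ∑-filter (forest? k i j) parentMaps (weight w ∘ toSubgraph) ⟩
      ∑[ P ∈ parentMaps ] 𝟙 (forest? k i j P) * weight w (toSubgraph P)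
                                                               ≡⟨ ∑-cong parentMaps (𝟙-forest? k i j) ⟩
      forestMatrix k i j                                       ∎
      where
        open ≡-Reasoning
        xs↭forests : xs ↭ forests k i j
        xs↭forests = ∼bag⇒↭ (unique∧set⇒bag !xs (forests-unique k i j)
                                            (λ {S} → ⇔.trans (xs⇔ S) (⇔.sym (∈-forests⇔ k i j))))

gammaFrom-nonNeg : {n : ℕ} (Q : WMat n) {i j : Fin n} → 0ℚ ≤ Q i j → i ≢ j → gammaFrom Q i j ≡ Q i j
gammaFrom-nonNeg Q {i} {j} 0≤Q i≢j with i ≟ j
... | yes i≡j = ⊥-elim (i≢j i≡j)
... | no  _ with 0ℚ ℚ.<? Q i j
...   | yes _   = refl
...   | no  0≮Q = ℚₚ.≤-antisym 0≤Q (ℚₚ.≮⇒≥ 0≮Q)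

proposition5 : (n : ℕ) → 1 < n → (w : WMat n) → IsWeightedDigraph w →
    (k : ℕ) → (Qk Qk+1 : WMat n) → IsQ w k Qk → IsQ w (suc k) Qk+1 →
    ∀ i j → (laplacian w · Qk) i j ≡ laplacian (gammaFrom Qk+1) i j
proposition5 n _ w (_ , w≥0) k Qk Qk+1 isQk isQk+1 i j = begin
  (laplacian w · Qk) i j               ≡⟨ ·-congʳ (laplacian w) Qk (forestMatrix k) i j (λ l → IsQ⇒forestMatrix w w≥0 isQk l j) ⟩
  (laplacian w · forestMatrix k) i j   ≡⟨ laplacian·forestMatrix k i j ⟩
  laplacian (forestMatrix (suc k)) i j ≡⟨ laplacian-cong (gammaFrom Qk+1) (forestMatrix (suc k)) i Γ≡F j ⟨
  laplacian (gammaFrom Qk+1) i j       ∎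
  where
    open ≡-Reasoning
    open ForestMatrix w
    Qk+1≡F : ∀ m → Qk+1 i m ≡ forestMatrix (suc k) i m
    Qk+1≡F = IsQ⇒forestMatrix w w≥0 isQk+1 i
    Γ≡F : ∀ m → i ≢ m → gammaFrom Qk+1 i m ≡ forestMatrix (suc k) i m
    Γ≡F m i≢m = ≡.trans (gammaFrom-nonNeg Qk+1 (≡.subst (0ℚ ≤_) (sym (Qk+1≡F m)) (forestMatrix-nonNeg w w≥0 (suc k) i m)) i≢m)
                        (Qk+1≡F m)
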